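{- Let $G$ be a split graph. Then $\overrightarrow{\chi}(G)\leq 2\omega(G)-2$.
   Context: An orientation $D$ of a graph $G$ replaces each edge by exactly one of its two possible arcs; $d^-_D(v)$ is the indegree of $v$. $D$ is proper if adjacent vertices have distinct indegrees; a $k$-orientation has maximum indegree at most $k$. $\overrightarrow{\chi}(G)$ is the minimum $k$ such that $G$ admits a proper $k$-orientation; $\omega(G)$ is the clique number. A split graph is a graph whose vertex set can be partitioned into a clique and an independent set. -}

module Defs where

open import Data.Nat using (ℕ; _≤_; _*_; _∸_)
open import Data.Bool using (Bool; true; false; if_then_else_)
open import Data.Fin using (Fin)
open import Data.Fin.Subset using (Subset; _∈_; ∁; ∣_∣)
open import Data.List using (map; allFin)
open import Data.Nat.ListAction using (sum)
open import Data.Product using (Σ; _×_; ∃)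
open import Data.Sum using (_⊎_)
open import Relation.Binary.PropositionalEquality using (_≡_; _≢_)

record Graph (n : ℕ) : Set where
  field
    adj    : Fin n → Fin n → Bool
    sym    : ∀ u v → adj u v ≡ adj v u
    irrefl : ∀ v → adj v v ≡ false
open Graph public

record Orientation {n : ℕ} (G : Graph n) : Set where
  field
    arc       : Fin n → Fin n → Bool
    arc⇒edge  : ∀ u v → arc u v ≡ true → adj G u v ≡ true
    edge⇒arc  : ∀ u v → adj G u v ≡ true → (arc u v ≡ true) ⊎ (arc v u ≡ true)
    not-both  : ∀ u v → arc u v ≡ true → arc v u ≡ false
open Orientation public

indeg : {n : ℕ} {G : Graph n} → Orientation G → Fin n → ℕ
indeg {n} D v = sum (map (λ u → if arc D u v then 1 else 0) (allFin n))

Proper : {n : ℕ} {G : Graph n} → Orientation G → Set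
Proper {n} {G} D = ∀ u v → adj G u v ≡ true → indeg D u ≢ indeg D v

IsKOrientation : {n : ℕ} {G : Graph n} → ℕ → Orientation G → Set
IsKOrientation {n} k D = ∀ v → indeg D v ≤ k

-- χ→(G) ≤ k  ⇔  G admits a proper k-orientation (χ→ is the minimum such k,
-- and a proper k'-orientation with k' ≤ k is a proper k-orientation).
ProperOrientedChromatic≤ : {n : ℕ} → Graph n → ℕ → Set
ProperOrientedChromatic≤ G k = Σ (Orientation G) λ D → Proper D × IsKOrientation k D

IsClique : {n : ℕ} → Graph n → Subset n → Set
IsClique G S = ∀ u v → u ∈ S → v ∈ S → u ≢ v → adj G u v ≡ true

IsIndependent : {n : ℕ} → Graph n → Subset n → Set
IsIndependent G S = ∀ u v → u ∈ S → v ∈ S → adj G u v ≡ false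

IsCliqueNumber : {n : ℕ} → Graph n → ℕ → Set
IsCliqueNumber G ω =
  (Σ (Subset _) λ S → IsClique G S × ∣ S ∣ ≡ ω) ×
  (∀ S → IsClique G S → ∣ S ∣ ≤ ω)

IsSplit : {n : ℕ} → Graph n → Set
IsSplit G = Σ (Subset _) λ K → IsClique G K × IsIndependent G (∁ K)

-- Write V = K ∪ I with K a clique and I independent, and fix v₁ ∈ K. The closed neighbourhood
-- of u ∈ I lies in the clique K ∪ {u}, so deg u < ω. Call w ∈ K ∖ {v₁} heavy if it has at least
-- ω neighbours in I and light otherwise. Orient K transitively along the lexicographic order of
-- (tier, index), where the tier is 0 for v₁, 1 for heavy and 2 + dᴵ w for light vertices, so that
-- w ∈ K gets pos w < |K| ≤ ω arcs from K. Of its edges to I, v₁ receives none, a light vertex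
-- receives all, and a heavy w receives exactly quota w = m + #{light x : #low + dᴵ x ≤ m + pos w},
-- where #low counts v₁ and the heavy vertices and m = min(#low, ω − 1). A vertex of I then has
-- indegree at most m, and at least 1 if adjacent to v₁. Inside K indegrees increase strictly within
-- each tier, and the quota makes a heavy w end above a light x exactly when x is counted in it.
-- Every indegree is a sum of two numbers below ω.

module Submission where

open import Defs hiding (sym)
open import Data.Nat
  using (ℕ; zero; suc; pred; >-nonZero; _+_; _*_; _∸_; _≤_; _<_; _⊓_; _<?_; _≤?_; z≤n; s≤s)
open import Data.Nat.Properties
open import Data.Nat.ListAction using (sum)
open import Data.Bool using (Bool; true; false; _∧_; _∨_; not; if_then_else_)
open import Data.Bool.Properties using (∧-zeroʳ; ∧-identityʳ; ∨-zeroʳ)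
open import Data.Fin using (Fin; zero; suc; toℕ) renaming (_≟_ to _≟ᶠ_)
open import Data.Fin.Properties using (toℕ-injective; toℕ<n)
open import Data.Fin.Subset using (Subset; _∈_; ∁; ∣_∣)
open import Data.Fin.Subset.Properties using (nonempty?; x∉p⇒x∈∁p)
open import Data.List using (map; allFin)
open import Data.List.Properties using (map-tabulate)
open import Data.Vec using (lookup; _∷_; [])
open import Data.Vec.Properties using (lookup⇒[]=; []=⇒lookup; lookup-map; lookup∘tabulate)
open import Data.Product using (_,_)
open import Data.Sum using (_⊎_; inj₁; inj₂)
open import Data.Empty using (⊥; ⊥-elim)
open import Function using (_∘_; id; case_of_)
open import Relation.Nullary using (¬_; Dec; yes; no; does)
open import Relation.Nullary.Decidable using (dec-true; dec-false)
open import Relation.Binary.Definitions using (tri<; tri≈; tri>)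
open import Relation.Binary.PropositionalEquality
open import Algebra.Properties.CommutativeSemigroup +-commutativeSemigroup
  using (interchange; x∙yz≈xz∙y; x∙yz≈yx∙z; xy∙z≈xz∙y)

does-true⇒ : ∀ {a} {A : Set a} (a? : Dec A) → does a? ≡ true → A
does-true⇒ (yes a) _  = a
does-true⇒ (no _)  ()

∧-true : ∀ {x y} → x ≡ true → y ≡ true → x ∧ y ≡ true
∧-true refl refl = refl

∧-trueˡ : ∀ {x y} → x ∧ y ≡ true → x ≡ true
∧-trueˡ {true} _ = refl

∧-trueʳ : ∀ {x y} → x ∧ y ≡ true → y ≡ true
∧-trueʳ {true} y≡true = y≡true

true⊎false : ∀ b → b ≡ true ⊎ b ≡ false
true⊎false true  = inj₁ refl
true⊎false false = inj₂ refl

∨-true : ∀ {x y} → x ∨ y ≡ true → x ≡ true ⊎ y ≡ true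
∨-true {true}  _      = inj₁ refl
∨-true {false} y≡true = inj₂ y≡true

private
  variable
    n : ℕ

bit : Bool → ℕ
bit b = if b then 1 else 0

count : (Fin n → Bool) → ℕ
count {zero}  p = 0
count {suc n} p = bit (p zero) + count (p ∘ suc)

_⊆ᵇ_ : (Fin n → Bool) → (Fin n → Bool) → Set
p ⊆ᵇ q = ∀ i → p i ≡ true → q i ≡ true

sum-bits≡count : (p : Fin n → Bool) → sum (map (bit ∘ p) (allFin n)) ≡ count p
sum-bits≡count p = trans (cong sum (map-tabulate id (bit ∘ p))) (sum-tabulate p)
  where
  sum-tabulate : ∀ {n} (p : Fin n → Bool) → sum (Data.List.tabulate (bit ∘ p)) ≡ count p
  sum-tabulate {zero}  p = refl
  sum-tabulate {suc n} p = cong (bit (p zero) +_) (sum-tabulate (p ∘ suc))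

∣∣≡count : (S : Subset n) → ∣ S ∣ ≡ count (lookup S)
∣∣≡count []          = refl
∣∣≡count (true ∷ S)  = cong suc (∣∣≡count S)
∣∣≡count (false ∷ S) = ∣∣≡count S

count-cong : {p q : Fin n → Bool} → (∀ i → p i ≡ q i) → count p ≡ count q
count-cong {zero}  _   = refl
count-cong {suc n} p≗q = cong₂ _+_ (cong bit (p≗q zero)) (count-cong (p≗q ∘ suc))

count-zero : {p : Fin n → Bool} → (∀ i → p i ≡ false) → count p ≡ 0
count-zero {zero}  _ = refl
count-zero {suc n} p≡false rewrite p≡false zero = count-zero (p≡false ∘ suc)

bit-mono : ∀ {a b} → (a ≡ true → b ≡ true) → bit a ≤ bit b
bit-mono {false} _   = z≤n
bit-mono {true}  a⇒b rewrite a⇒b refl = ≤-refl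

count-mono : {p q : Fin n → Bool} → p ⊆ᵇ q → count p ≤ count q
count-mono {zero}  _   = z≤n
count-mono {suc n} p⊆q = +-mono-≤ (bit-mono (p⊆q zero)) (count-mono (p⊆q ∘ suc))

count-mono-< : {p q : Fin n → Bool} → p ⊆ᵇ q → ∀ w → p w ≡ false → q w ≡ true → count p < count q
count-mono-< {suc n} p⊆q zero pw qw rewrite pw | qw = s≤s (count-mono (p⊆q ∘ suc))
count-mono-< {suc n} p⊆q (suc w) pw qw =
  +-mono-≤-< (bit-mono (p⊆q zero)) (count-mono-< (p⊆q ∘ suc) w pw qw)

count-pos : {p : Fin n → Bool} → ∀ w → p w ≡ true → 0 < count p
count-pos {n} {p} w pw =
  subst (_< count p) (count-zero {n} (λ _ → refl)) (count-mono-< (λ _ ()) w refl pw)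

count-+ : {p q r : Fin n → Bool} → (∀ i → bit (r i) ≡ bit (p i) + bit (q i)) →
  count r ≡ count p + count q
count-+ {zero}  _     = refl
count-+ {suc n} {p} {q} split =
  trans (cong₂ _+_ (split zero) (count-+ (split ∘ suc)))
        (interchange (bit (p zero)) (bit (q zero)) (count (p ∘ suc)) (count (q ∘ suc)))

rankIn : (Fin n → Bool) → Fin n → ℕ
rankIn p u = count (λ v → p v ∧ does (toℕ v <? toℕ u))

count-rank< : (p : Fin n → Bool) (r : ℕ) → count (λ u → p u ∧ does (rankIn p u <? r)) ≡ r ⊓ count p
count-rank< {zero}  p r = sym (⊓-zeroʳ r)
count-rank< {suc n} p r = begin
    count (λ u → p u ∧ does (rankIn p u <? r))
  ≡⟨ cong₂ _+_ (cong (λ k → bit (p zero ∧ does (k <? r))) rankIn-zero)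
               (count-cong λ x → cong (λ b → p (suc x) ∧ does (bit b + rankIn (p ∘ suc) x <? r))
                                      (∧-identityʳ (p zero))) ⟩
    bit (p zero ∧ does (0 <? r)) + count (λ x → p (suc x) ∧ does (bit (p zero) + rankIn (p ∘ suc) x <? r))
  ≡⟨ by-head (p zero) r ⟩
    r ⊓ count p
  ∎
  where
  open ≡-Reasoning
  rankIn-zero : rankIn p zero ≡ 0
  rankIn-zero = count-zero (λ v → ∧-zeroʳ (p v))
  by-head : ∀ b r →
    bit (b ∧ does (0 <? r)) + count (λ x → p (suc x) ∧ does (bit b + rankIn (p ∘ suc) x <? r))
                    ≡ r ⊓ (bit b + count (p ∘ suc))
  by-head false r       = count-rank< (p ∘ suc) r
  by-head true  zero    = count-zero (λ x → ∧-zeroʳ (p (suc x)))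
  by-head true  (suc r) = cong suc (count-rank< (p ∘ suc) r)

lexKey : (Fin n → ℕ) → Fin n → ℕ
lexKey {n} f a = f a * n + toℕ a

module _ (f : Fin n → ℕ) where

  lexKey-< : ∀ {a b} → f a < f b → lexKey f a < lexKey f b
  lexKey-< {a} {b} fa<fb = begin-strict
      f a * n + toℕ a  <⟨ +-monoʳ-< (f a * n) (toℕ<n a) ⟩
      f a * n + n      ≡⟨ +-comm (f a * n) n ⟩
      suc (f a) * n    ≤⟨ *-monoˡ-≤ n fa<fb ⟩
      f b * n          ≤⟨ m≤m+n (f b * n) (toℕ b) ⟩
      lexKey f b       ∎
    where open ≤-Reasoning

  lexKey-<⇒≤ : ∀ {a b} → lexKey f a < lexKey f b → f a ≤ f b
  lexKey-<⇒≤ {a} {b} ka<kb = ≮⇒≥ (λ fb<fa → <-asym ka<kb (lexKey-< fb<fa))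

  lexKey-injective : ∀ {a b} → lexKey f a ≡ lexKey f b → a ≡ b
  lexKey-injective {a} {b} ka≡kb with <-cmp (f a) (f b)
  ... | tri< fa<fb _ _ = ⊥-elim (<⇒≢ (lexKey-< fa<fb) ka≡kb)
  ... | tri> _ _ fb<fa = ⊥-elim (<⇒≢ (lexKey-< fb<fa) (sym ka≡kb))
  ... | tri≈ _ fa≡fb _ =
    toℕ-injective (+-cancelˡ-≡ (f a * n) _ _
      (subst (λ x → f a * n + toℕ a ≡ x * n + toℕ b) (sym fa≡fb) ka≡kb))

x+y≤2*w∸2 : ∀ {x y w} → x < w → y < w → x + y ≤ 2 * w ∸ 2
x+y≤2*w∸2 {x} {y} {w} x<w y<w = m+n≤o⇒m≤o∸n (x + y) (begin
    x + y + 2            ≡⟨ +-assoc x y 2 ⟩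
    x + (y + 2)          ≡⟨ cong (x +_) (+-comm y 2) ⟩
    x + suc (suc y)      ≡⟨ +-suc x (suc y) ⟩
    suc x + suc y        ≤⟨ +-mono-≤ x<w y<w ⟩
    w + w                ≡⟨ cong (w +_) (sym (+-identityʳ w)) ⟩
    2 * w                ∎)
  where open ≤-Reasoning

module _ (G : Graph n) where

  adj⇒≢ : ∀ {u v} → adj G u v ≡ true → u ≢ v
  adj⇒≢ {u} uv refl with () ← trans (sym uv) (irrefl G u)

  degree : Fin n → ℕ
  degree u = count (adj G u)

  simplicial⇒degree< : ∀ {ω u} → (∀ S → IsClique G S → ∣ S ∣ ≤ ω) →
    (∀ a b → adj G u a ≡ true → adj G u b ≡ true → a ≢ b → adj G a b ≡ true) →
    degree u < ω
  simplicial⇒degree< {ω} {u} clique≤ω N[u]-clique = begin-strict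
      degree u                <⟨ count-mono-< (λ a ua → cong (_∨ _) ua) u (irrefl G u) u∈N[u] ⟩
      count N[u]              ≡⟨ count-cong (λ a → sym (lookup∘tabulate N[u] a)) ⟩
      count (lookup S)        ≡⟨ sym (∣∣≡count S) ⟩
      ∣ S ∣                   ≤⟨ clique≤ω S S-clique ⟩
      ω                       ∎
    where
    open ≤-Reasoning
    N[u] : Fin n → Bool
    N[u] a = adj G u a ∨ does (a ≟ᶠ u)
    u∈N[u] : N[u] u ≡ true
    u∈N[u] = trans (cong (adj G u u ∨_) (dec-true (u ≟ᶠ u) refl)) (∨-zeroʳ _)
    S : Subset n
    S = Data.Vec.tabulate N[u]
    S-clique : IsClique G S
    S-clique a b a∈S b∈S a≢b
      with ∨-true (trans (sym (lookup∘tabulate N[u] a)) ([]=⇒lookup a∈S))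
         | ∨-true (trans (sym (lookup∘tabulate N[u] b)) ([]=⇒lookup b∈S))
    ... | inj₁ ua | inj₁ ub = N[u]-clique a b ua ub a≢b
    ... | inj₁ ua | inj₂ b≡u rewrite does-true⇒ (b ≟ᶠ u) b≡u = trans (Graph.sym G a u) ua
    ... | inj₂ a≡u | inj₁ ub rewrite does-true⇒ (a ≟ᶠ u) a≡u = ub
    ... | inj₂ a≡u | inj₂ b≡u =
      ⊥-elim (a≢b (trans (does-true⇒ (a ≟ᶠ u) a≡u) (sym (does-true⇒ (b ≟ᶠ u) b≡u))))

  edgeless⇒ProperOrientedChromatic≤ : ∀ k → (∀ u v → adj G u v ≡ false) → ProperOrientedChromatic≤ G k
  edgeless⇒ProperOrientedChromatic≤ k no-edge = D , proper , bounded
    where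
    no-arc : ∀ {u v} → adj G u v ≡ true → ⊥
    no-arc {u} {v} uv with () ← trans (sym uv) (no-edge u v)
    D : Orientation G
    D = record { arc = λ _ _ → false ; arc⇒edge = λ _ _ () ; edge⇒arc = λ _ _ → ⊥-elim ∘ no-arc
               ; not-both = λ _ _ _ → refl }
    proper : Proper D
    proper _ _ = ⊥-elim ∘ no-arc
    bounded : IsKOrientation k D
    bounded v =
      subst (_≤ k) (sym (trans (sum-bits≡count {n} (λ _ → false)) (count-zero {n} (λ _ → refl)))) z≤n

module SplitOrientation {n : ℕ} (G : Graph n) (ω : ℕ) (K : Subset n)
  (K-clique : IsClique G K) (I-independent : IsIndependent G (∁ K))
  (clique≤ω : ∀ S → IsClique G S → ∣ S ∣ ≤ ω)
  (v₁ : Fin n) (v₁∈K : lookup K v₁ ≡ true) where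

  inK : Fin n → Bool
  inK = lookup K

  ∈K : ∀ {u} → inK u ≡ true → u ∈ K
  ∈K {u} = lookup⇒[]= u K

  ∈I : ∀ {u} → inK u ≡ false → u ∈ ∁ K
  ∈I {u} u∉K = lookup⇒[]= u (∁ K) (trans (lookup-map u not K) (cong not u∉K))

  I-nonadjacent : ∀ {a b} → inK a ≡ false → inK b ≡ false → adj G a b ≡ false
  I-nonadjacent a∉K b∉K = I-independent _ _ (∈I a∉K) (∈I b∉K)

  I-neighbour∈K : ∀ {u w} → inK u ≡ false → adj G u w ≡ true → inK w ≡ true
  I-neighbour∈K {u} {w} u∉K uw with inK w in w∈?K
  ... | true  = refl
  ... | false with () ← trans (sym uw) (I-nonadjacent u∉K w∈?K)

  |K|≤ω : count inK ≤ ω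
  |K|≤ω = subst (_≤ ω) (∣∣≡count K) (clique≤ω K K-clique)

  0<ω : 0 < ω
  0<ω = ≤-trans (count-pos v₁ v₁∈K) |K|≤ω

  I-degree<ω : ∀ {u} → inK u ≡ false → degree G u < ω
  I-degree<ω u∉K = simplicial⇒degree< G clique≤ω
    (λ a b ua ub → K-clique a b (∈K (I-neighbour∈K u∉K ua)) (∈K (I-neighbour∈K u∉K ub)))

  Nᴵ : Fin n → Fin n → Bool
  Nᴵ w u = not (inK u) ∧ adj G u w

  dᴵ : Fin n → ℕ
  dᴵ w = count (Nᴵ w)

  data Role : Set where
    root heavy light : Role

  -- Only meaningful on K.
  role : Fin n → Role
  role w with w ≟ᶠ v₁ | ω ≤? dᴵ w
  ... | yes _ | _     = root
  ... | no _  | yes _ = heavy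
  ... | no _  | no _  = light

  role-v₁ : role v₁ ≡ root
  role-v₁ with v₁ ≟ᶠ v₁ | ω ≤? dᴵ v₁
  ... | yes _    | _ = refl
  ... | no v₁≢v₁ | _ = ⊥-elim (v₁≢v₁ refl)

  root⇒≡v₁ : ∀ {w} → role w ≡ root → w ≡ v₁
  root⇒≡v₁ {w} ρ with w ≟ᶠ v₁ | ω ≤? dᴵ w
  ... | yes w≡v₁ | _     = w≡v₁
  ... | no _     | yes _ with () ← ρ
  ... | no _     | no _  with () ← ρ

  heavy⇒ω≤dᴵ : ∀ {w} → role w ≡ heavy → ω ≤ dᴵ w
  heavy⇒ω≤dᴵ {w} ρ with w ≟ᶠ v₁ | ω ≤? dᴵ w
  ... | no _  | yes ω≤d = ω≤d
  ... | yes _ | _       with () ← ρ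
  ... | no _  | no _    with () ← ρ

  light⇒dᴵ<ω : ∀ {w} → role w ≡ light → dᴵ w < ω
  light⇒dᴵ<ω {w} ρ with w ≟ᶠ v₁ | ω ≤? dᴵ w
  ... | no _  | no ω≰d = ≰⇒> ω≰d
  ... | yes _ | _      with () ← ρ
  ... | no _  | yes _  with () ← ρ

  level : Role → ℕ → ℕ
  level root  _ = 0
  level heavy _ = 1
  level light d = 2 + d

  tier : Fin n → ℕ
  tier w = level (role w) (dᴵ w)

  tier-v₁ : tier v₁ ≡ 0
  tier-v₁ = cong (λ ρ → level ρ (dᴵ v₁)) role-v₁

  tier-heavy : ∀ {w} → role w ≡ heavy → tier w ≡ 1
  tier-heavy {w} ρ = cong (λ ρ → level ρ (dᴵ w)) ρ

  tier-light : ∀ {w} → role w ≡ light → tier w ≡ 2 + dᴵ w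
  tier-light {w} ρ = cong (λ ρ → level ρ (dᴵ w)) ρ

  0<tier : ∀ {w} → w ≢ v₁ → 0 < tier w
  0<tier {w} w≢v₁ with role w in ρ
  ... | root  = ⊥-elim (w≢v₁ (root⇒≡v₁ ρ))
  ... | heavy = s≤s z≤n
  ... | light = s≤s z≤n

  infix 4 _≺_ _≺ᵇ_

  _≺_ : Fin n → Fin n → Set
  a ≺ b = lexKey tier a < lexKey tier b

  _≺ᵇ_ : Fin n → Fin n → Bool
  a ≺ᵇ b = does (lexKey tier a <? lexKey tier b)

  ≺ᵇ⇒≺ : ∀ a b → (a ≺ᵇ b) ≡ true → a ≺ b
  ≺ᵇ⇒≺ a b = does-true⇒ (lexKey tier a <? lexKey tier b)

  ≺⇒≺ᵇ : ∀ a b → a ≺ b → (a ≺ᵇ b) ≡ true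
  ≺⇒≺ᵇ a b = dec-true (lexKey tier a <? lexKey tier b)

  ≺ᵇ-irrefl : ∀ a → (a ≺ᵇ a) ≡ false
  ≺ᵇ-irrefl a = dec-false (lexKey tier a <? lexKey tier a) (<-irrefl refl)

  ≺-connex : ∀ a b → a ≢ b → a ≺ b ⊎ b ≺ a
  ≺-connex a b a≢b with <-cmp (lexKey tier a) (lexKey tier b)
  ... | tri< a≺b _ _ = inj₁ a≺b
  ... | tri≈ _ a≈b _ = ⊥-elim (a≢b (lexKey-injective tier {a} {b} a≈b))
  ... | tri> _ _ b≺a = inj₂ b≺a

  ¬≺v₁ : ∀ a → ¬ (a ≺ v₁)
  ¬≺v₁ a a≺v₁ = case a ≟ᶠ v₁ of λ where
    (yes a≡v₁) → <-irrefl (cong (lexKey tier) a≡v₁) a≺v₁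
    (no a≢v₁)  → <-irrefl (sym tier-v₁) (≤-trans (0<tier a≢v₁) (lexKey-<⇒≤ tier {a} {v₁} a≺v₁))

  v₁≺ : ∀ b → b ≢ v₁ → v₁ ≺ b
  v₁≺ b b≢v₁ = lexKey-< tier {v₁} {b} (subst (_< tier b) (sym tier-v₁) (0<tier b≢v₁))

  data RoleView (w : Fin n) : Set where
    is-v₁    : w ≡ v₁ → RoleView w
    is-heavy : role w ≡ heavy → RoleView w
    is-light : role w ≡ light → RoleView w

  roleView : ∀ w → RoleView w
  roleView w with role w in ρ
  ... | root  = is-v₁ (root⇒≡v₁ ρ)
  ... | heavy = is-heavy ρ
  ... | light = is-light ρ

  heavy⇒≢v₁ : ∀ {w} → role w ≡ heavy → w ≢ v₁
  heavy⇒≢v₁ ρ refl with () ← trans (sym ρ) role-v₁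

  pos : Fin n → ℕ
  pos b = count (λ a → inK a ∧ (a ≺ᵇ b))

  not-before-self : ∀ a → (inK a ∧ (a ≺ᵇ a)) ≡ false
  not-before-self a = trans (cong (inK a ∧_) (≺ᵇ-irrefl a)) (∧-zeroʳ _)

  pos-v₁ : pos v₁ ≡ 0
  pos-v₁ = count-zero (λ a → trans (cong (inK a ∧_) (dec-false (_ <? _) (¬≺v₁ a))) (∧-zeroʳ _))

  pos-mono : ∀ a b → inK a ≡ true → a ≺ b → pos a < pos b
  pos-mono a b a∈K a≺b = count-mono-<
    (λ x x≺a → ∧-true (∧-trueˡ x≺a) (≺⇒≺ᵇ x b (<-trans (≺ᵇ⇒≺ x a (∧-trueʳ x≺a)) a≺b)))
    a (not-before-self a) (∧-true a∈K (≺⇒≺ᵇ a b a≺b))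

  pos<|K| : ∀ b → inK b ≡ true → pos b < count inK
  pos<|K| b b∈K = count-mono-< (λ _ → ∧-trueˡ) b (not-before-self b) b∈K

  0<pos : ∀ b → b ≢ v₁ → 0 < pos b
  0<pos b b≢v₁ = count-pos v₁ (∧-true v₁∈K (≺⇒≺ᵇ v₁ b (v₁≺ b b≢v₁)))

  isLow : Role → Bool
  isLow light = false
  isLow _     = true

  isLow⇒level≤1 : ∀ ρ d → isLow ρ ≡ true → level ρ d ≤ 1
  isLow⇒level≤1 root  _ _ = z≤n
  isLow⇒level≤1 heavy _ _ = ≤-refl
  isLow⇒level≤1 light _ ()

  level≤1⇒isLow : ∀ ρ d → level ρ d ≤ 1 → isLow ρ ≡ true
  level≤1⇒isLow root  _ _             = refl
  level≤1⇒isLow heavy _ _             = refl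
  level≤1⇒isLow light _ (s≤s ())

  ¬isLow⇒light : ∀ ρ → not (isLow ρ) ≡ true → ρ ≡ light
  ¬isLow⇒light light _ = refl

  lowK : Fin n → Bool
  lowK a = inK a ∧ isLow (role a)

  lightK : Fin n → Bool
  lightK a = inK a ∧ not (isLow (role a))

  lightK⇒light : ∀ a → lightK a ≡ true → role a ≡ light
  lightK⇒light a h = ¬isLow⇒light (role a) (∧-trueʳ {inK a} h)

  #low : ℕ
  #low = count lowK

  #light : ℕ
  #light = count lightK

  |K|≡#low+#light : count inK ≡ #low + #light
  |K|≡#low+#light = count-+ split
    where
    split : ∀ a → bit (inK a) ≡ bit (lowK a) + bit (lightK a)
    split a with inK a | isLow (role a)
    ... | false | _     = refl
    ... | true  | true  = refl
    ... | true  | false = refl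

  low≺light : ∀ a b → isLow (role a) ≡ true → role b ≡ light → a ≺ b
  low≺light a b a-low ρb = lexKey-< tier {a} {b} (begin-strict
      tier a     ≤⟨ isLow⇒level≤1 (role a) (dᴵ a) a-low ⟩
      1          <⟨ s≤s (s≤s z≤n) ⟩
      2 + dᴵ b   ≡⟨ sym (tier-light ρb) ⟩
      tier b     ∎)
    where open ≤-Reasoning

  light≺light⇒dᴵ≤ : ∀ a b → role a ≡ light → role b ≡ light → a ≺ b → dᴵ a ≤ dᴵ b
  light≺light⇒dᴵ≤ a b ρa ρb a≺b =
    ≤-pred (≤-pred (subst₂ _≤_ (tier-light ρa) (tier-light ρb) (lexKey-<⇒≤ tier {a} {b} a≺b)))

  light-dᴵ<⇒≺ : ∀ a b → role a ≡ light → role b ≡ light → dᴵ a < dᴵ b → a ≺ b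
  light-dᴵ<⇒≺ a b ρa ρb da<db =
    lexKey-< tier {a} {b} (subst₂ _<_ (sym (tier-light ρa)) (sym (tier-light ρb)) (s≤s (s≤s da<db)))

  lightBefore : Fin n → ℕ
  lightBefore b = count (λ x → lightK x ∧ (x ≺ᵇ b))

  pos-light : ∀ b → role b ≡ light → pos b ≡ #low + lightBefore b
  pos-light b ρb = count-+ split
    where
    split : ∀ x → bit (inK x ∧ (x ≺ᵇ b)) ≡ bit (lowK x) + bit (lightK x ∧ (x ≺ᵇ b))
    split x with inK x
    ... | false = refl
    ... | true with isLow (role x) in x-low
    ...   | false = refl
    ...   | true  = cong bit (≺⇒≺ᵇ x b (low≺light x b x-low ρb))

  pos-heavy<#low : ∀ b → inK b ≡ true → role b ≡ heavy → pos b < #low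
  pos-heavy<#low b b∈K ρb = count-mono-< before⇒low b (not-before-self b) (∧-true b∈K (cong isLow ρb))
    where
    before⇒low : ∀ x → (inK x ∧ (x ≺ᵇ b)) ≡ true → lowK x ≡ true
    before⇒low x h = ∧-true (∧-trueˡ h) (level≤1⇒isLow (role x) (dᴵ x)
      (≤-trans (lexKey-<⇒≤ tier {x} {b} (≺ᵇ⇒≺ x b (∧-trueʳ {inK x} h)))
               (≤-reflexive (tier-heavy ρb))))

  m : ℕ
  m = #low ⊓ pred ω

  m<ω : m < ω
  m<ω = m≤pred[n]⇒suc[m]≤n {{>-nonZero 0<ω}} (m⊓n≤n #low (pred ω))

  lightBelow : Fin n → ℕ
  lightBelow b = count (λ x → lightK x ∧ does (#low + dᴵ x ≤? m + pos b))

  quota : Fin n → ℕ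
  quota b = m + lightBelow b

  lightBelow≤#light : ∀ b → lightBelow b ≤ #light
  lightBelow≤#light b = count-mono (λ x → ∧-trueˡ {lightK x})

  quota≤dᴵ : ∀ b → role b ≡ heavy → quota b ≤ dᴵ b
  quota≤dᴵ b ρb = begin
      m + lightBelow b  ≤⟨ +-mono-≤ (m⊓n≤m #low (pred ω)) (lightBelow≤#light b) ⟩
      #low + #light     ≡⟨ sym |K|≡#low+#light ⟩
      count inK         ≤⟨ |K|≤ω ⟩
      ω                 ≤⟨ heavy⇒ω≤dᴵ ρb ⟩
      dᴵ b              ∎
    where open ≤-Reasoning

  admits : Role → Bool → Bool
  admits root  _     = false
  admits heavy early = early
  admits light _     = true

  takes : Fin n → Fin n → Bool
  takes w u = admits (role w) (does (rankIn (Nᴵ w) u <? quota w))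

  takes-v₁ : ∀ u → takes v₁ u ≡ false
  takes-v₁ u = cong (λ ρ → admits ρ (does (rankIn (Nᴵ v₁) u <? quota v₁))) role-v₁

  takes-heavy : ∀ w u → role w ≡ heavy → takes w u ≡ does (rankIn (Nᴵ w) u <? quota w)
  takes-heavy w u ρ = cong (λ ρ → admits ρ (does (rankIn (Nᴵ w) u <? quota w))) ρ

  takes-light : ∀ w u → role w ≡ light → takes w u ≡ true
  takes-light w u ρ = cong (λ ρ → admits ρ (does (rankIn (Nᴵ w) u <? quota w))) ρ

  arc′ : Fin n → Fin n → Bool
  arc′ a b = if inK a then (if inK b then a ≺ᵇ b else adj G a b ∧ not (takes a b))
                      else (if inK b then adj G a b ∧ takes b a else false)

  arc′⇒edge : ∀ a b → arc′ a b ≡ true → adj G a b ≡ true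
  arc′⇒edge a b ab with inK a in a∈? | inK b in b∈?
  ... | true  | true  =
    K-clique a b (∈K a∈?) (∈K b∈?) (λ a≡b → <-irrefl (cong (lexKey tier) a≡b) (≺ᵇ⇒≺ a b ab))
  ... | true  | false = ∧-trueˡ ab
  ... | false | true  = ∧-trueˡ ab

  edge⇒arc′ : ∀ a b → adj G a b ≡ true → arc′ a b ≡ true ⊎ arc′ b a ≡ true
  edge⇒arc′ a b ab with inK a in a∈? | inK b in b∈?
  ... | true  | true  = Data.Sum.map (≺⇒≺ᵇ a b) (≺⇒≺ᵇ b a) (≺-connex a b (adj⇒≢ G ab))
  ... | false | false with () ← trans (sym ab) (I-nonadjacent a∈? b∈?)
  ... | true  | false with takes a b
  ...   | true  = inj₂ (trans (∧-identityʳ _) (trans (Graph.sym G b a) ab))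
  ...   | false = inj₁ (trans (∧-identityʳ _) ab)
  edge⇒arc′ a b ab | false | true with takes b a
  ...   | true  = inj₁ (trans (∧-identityʳ _) ab)
  ...   | false = inj₂ (trans (∧-identityʳ _) (trans (Graph.sym G b a) ab))

  arc′-asym : ∀ a b → arc′ a b ≡ true → arc′ b a ≡ false
  arc′-asym a b ab with inK a | inK b
  ... | true  | true  = dec-false (_ <? _) (<-asym (≺ᵇ⇒≺ a b ab))
  ... | true  | false with takes a b
  ...   | false = ∧-zeroʳ _
  ...   | true  with () ← trans (sym ab) (∧-zeroʳ _)
  arc′-asym a b ab | false | true with takes b a
  ...   | true  = ∧-zeroʳ _
  ...   | false with () ← trans (sym ab) (∧-zeroʳ _)

  D : Orientation G
  D = record { arc = arc′ ; arc⇒edge = arc′⇒edge ; edge⇒arc = edge⇒arc′ ; not-both = arc′-asym }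

  received : Fin n → ℕ
  received b = count (λ a → Nᴵ b a ∧ takes b a)

  sent : Fin n → ℕ
  sent u = count (λ a → inK a ∧ (adj G a u ∧ not (takes a u)))

  indeg-K : ∀ b → inK b ≡ true → indeg D b ≡ pos b + received b
  indeg-K b b∈K = trans (sum-bits≡count (λ a → arc′ a b)) (count-+ split)
    where
    split : ∀ a → bit (arc′ a b) ≡ bit (inK a ∧ (a ≺ᵇ b)) + bit (Nᴵ b a ∧ takes b a)
    split a rewrite b∈K with inK a
    ... | true  = sym (+-identityʳ _)
    ... | false = refl

  indeg-I : ∀ u → inK u ≡ false → indeg D u ≡ sent u
  indeg-I u u∉K = trans (sum-bits≡count (λ a → arc′ a u)) (count-cong pointwise)
    where
    pointwise : ∀ a → arc′ a u ≡ (inK a ∧ (adj G a u ∧ not (takes a u)))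
    pointwise a rewrite u∉K with inK a
    ... | true  = refl
    ... | false = refl

  indeg-v₁ : indeg D v₁ ≡ 0
  indeg-v₁ = trans (indeg-K v₁ v₁∈K) (cong₂ _+_ pos-v₁
    (count-zero (λ a → trans (cong (Nᴵ v₁ a ∧_) (takes-v₁ a)) (∧-zeroʳ _))))

  indeg-heavy : ∀ b → inK b ≡ true → role b ≡ heavy → indeg D b ≡ pos b + quota b
  indeg-heavy b b∈K ρb = trans (indeg-K b b∈K) (cong (pos b +_) (begin
      count (λ a → Nᴵ b a ∧ takes b a)
    ≡⟨ count-cong (λ a → cong (Nᴵ b a ∧_) (takes-heavy b a ρb)) ⟩
      count (λ a → Nᴵ b a ∧ does (rankIn (Nᴵ b) a <? quota b))
    ≡⟨ count-rank< (Nᴵ b) (quota b) ⟩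
      quota b ⊓ dᴵ b
    ≡⟨ m≤n⇒m⊓n≡m (quota≤dᴵ b ρb) ⟩
      quota b
    ∎))
    where open ≡-Reasoning

  indeg-light : ∀ b → inK b ≡ true → role b ≡ light → indeg D b ≡ pos b + dᴵ b
  indeg-light b b∈K ρb = trans (indeg-K b b∈K)
    (cong (pos b +_) (count-cong (λ a → trans (cong (Nᴵ b a ∧_) (takes-light b a ρb)) (∧-identityʳ _))))

  pos≤indeg : ∀ b → inK b ≡ true → pos b ≤ indeg D b
  pos≤indeg b b∈K = subst (pos b ≤_) (sym (indeg-K b b∈K)) (m≤m+n (pos b) (received b))

  sends⇒low : ∀ a u → not (takes a u) ≡ true → isLow (role a) ≡ true
  sends⇒low a u sends with role a
  sends⇒low a u sends | root  = refl
  sends⇒low a u sends | heavy = refl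
  sends⇒low a u ()    | light

  sent≤#low : ∀ u → sent u ≤ #low
  sent≤#low u = count-mono λ a h →
    ∧-true (∧-trueˡ h) (sends⇒low a u (∧-trueʳ {adj G a u} (∧-trueʳ {inK a} h)))

  sent<ω : ∀ u → inK u ≡ false → sent u < ω
  sent<ω u u∉K = ≤-<-trans
    (count-mono λ a h → trans (Graph.sym G u a) (∧-trueˡ (∧-trueʳ {inK a} h)))
    (I-degree<ω u∉K)

  sent≤m : ∀ u → inK u ≡ false → sent u ≤ m
  sent≤m u u∉K = ⊓-glb (sent≤#low u) (<⇒≤pred (sent<ω u u∉K))

  0<sent : ∀ u → adj G v₁ u ≡ true → 0 < sent u
  0<sent u v₁u = count-pos v₁ (∧-true v₁∈K (∧-true v₁u (cong not (takes-v₁ u))))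

  bounded : IsKOrientation (2 * ω ∸ 2) D
  bounded v with true⊎false (inK v)
  ... | inj₂ v∉K = begin
      indeg D v   ≡⟨ trans (indeg-I v v∉K) (sym (+-identityʳ (sent v))) ⟩
      sent v + 0  ≤⟨ x+y≤2*w∸2 (sent<ω v v∉K) 0<ω ⟩
      2 * ω ∸ 2   ∎
    where open ≤-Reasoning
  ... | inj₁ v∈K with roleView v
  ...   | is-v₁ refl = subst (_≤ 2 * ω ∸ 2) (sym indeg-v₁) z≤n
  ...   | is-light ρ = begin
      indeg D v        ≡⟨ indeg-light v v∈K ρ ⟩
      pos v + dᴵ v     ≤⟨ x+y≤2*w∸2 (<-≤-trans (pos<|K| v v∈K) |K|≤ω) (light⇒dᴵ<ω ρ) ⟩
      2 * ω ∸ 2        ∎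
    where open ≤-Reasoning
  ...   | is-heavy ρ = begin
      indeg D v                    ≡⟨ indeg-heavy v v∈K ρ ⟩
      pos v + (m + lightBelow v)   ≡⟨ x∙yz≈xz∙y (pos v) m (lightBelow v) ⟩
      pos v + lightBelow v + m     ≤⟨ x+y≤2*w∸2 pos+lightBelow<ω m<ω ⟩
      2 * ω ∸ 2                    ∎
    where
    open ≤-Reasoning
    pos+lightBelow<ω : pos v + lightBelow v < ω
    pos+lightBelow<ω = begin-strict
      pos v + lightBelow v  <⟨ +-mono-<-≤ (pos-heavy<#low v v∈K ρ) (lightBelow≤#light v) ⟩
      #low + #light         ≡⟨ sym |K|≡#low+#light ⟩
      count inK             ≤⟨ |K|≤ω ⟩
      ω                     ∎

  K-I-distinct : ∀ a u → inK u ≡ false → adj G a u ≡ true → indeg D a ≢ indeg D u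
  K-I-distinct a u u∉K au with true⊎false (inK a)
  ... | inj₂ a∉K with () ← trans (sym au) (I-nonadjacent a∉K u∉K)
  ... | inj₁ a∈K with roleView a
  ...   | is-v₁ refl = λ eq → <⇒≢ (0<sent u au) (trans (sym indeg-v₁) (trans eq (indeg-I u u∉K)))
  ...   | is-heavy ρ = >⇒≢ (begin-strict
      indeg D u        ≡⟨ indeg-I u u∉K ⟩
      sent u           ≤⟨ sent≤m u u∉K ⟩
      m                <⟨ +-monoˡ-≤ m (0<pos a (heavy⇒≢v₁ ρ)) ⟩
      pos a + m        ≤⟨ +-monoʳ-≤ (pos a) (m≤m+n m (lightBelow a)) ⟩
      pos a + quota a  ≡⟨ sym (indeg-heavy a a∈K ρ) ⟩
      indeg D a        ∎)
    where open ≤-Reasoning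
  ...   | is-light ρ = >⇒≢ (begin-strict
      indeg D u              ≡⟨ indeg-I u u∉K ⟩
      sent u                 ≤⟨ sent≤#low u ⟩
      #low                   ≤⟨ m≤m+n #low (lightBefore a) ⟩
      #low + lightBefore a   ≡⟨ sym (pos-light a ρ) ⟩
      pos a                  <⟨ m<m+n (pos a) (count-pos u u∈Nᴵa) ⟩
      pos a + dᴵ a           ≡⟨ sym (indeg-light a a∈K ρ) ⟩
      indeg D a              ∎)
    where
    open ≤-Reasoning
    u∈Nᴵa : Nᴵ a u ≡ true
    u∈Nᴵa = ∧-true (cong not u∉K) (trans (Graph.sym G u a) au)

  lightBelow-mono : ∀ a b → pos a ≤ pos b → lightBelow a ≤ lightBelow b
  lightBelow-mono a b pa≤pb = count-mono λ x h →
    ∧-true (∧-trueˡ {lightK x} h) (dec-true (#low + dᴵ x ≤? m + pos b)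
      (≤-trans (does-true⇒ (#low + dᴵ x ≤? m + pos a) (∧-trueʳ {lightK x} h)) (+-monoʳ-≤ m pa≤pb)))

  -- Both indegrees are a threshold plus a count of light vertices, and the comparison of the
  -- thresholds decides which count is larger.
  module _ (b w : Fin n) (b∈K : inK b ≡ true) (ρb : role b ≡ heavy)
           (w∈K : inK w ≡ true) (ρw : role w ≡ light) where

    indeg-heavy′ : indeg D b ≡ m + pos b + lightBelow b
    indeg-heavy′ = trans (indeg-heavy b b∈K ρb) (x∙yz≈yx∙z (pos b) m (lightBelow b))

    indeg-light′ : indeg D w ≡ #low + dᴵ w + lightBefore w
    indeg-light′ = trans (indeg-light w w∈K ρw)
      (trans (cong (_+ dᴵ w) (pos-light w ρw)) (xy∙z≈xz∙y #low (lightBefore w) (dᴵ w)))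

    lightBefore<lightBelow : #low + dᴵ w ≤ m + pos b → lightBefore w < lightBelow b
    lightBefore<lightBelow w≤b = count-mono-< before⇒below w
      (trans (cong (lightK w ∧_) (≺ᵇ-irrefl w)) (∧-zeroʳ _))
      (∧-true (∧-true w∈K (cong (not ∘ isLow) ρw)) (dec-true (_ ≤? _) w≤b))
      where
      before⇒below : ∀ x → (lightK x ∧ (x ≺ᵇ w)) ≡ true →
        (lightK x ∧ does (#low + dᴵ x ≤? m + pos b)) ≡ true
      before⇒below x h = ∧-true (∧-trueˡ h) (dec-true (_ ≤? _) (≤-trans
        (+-monoʳ-≤ #low (light≺light⇒dᴵ≤ x w (lightK⇒light x (∧-trueˡ h)) ρw
          (≺ᵇ⇒≺ x w (∧-trueʳ {lightK x} h))))
        w≤b))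

    lightBelow≤lightBefore : m + pos b < #low + dᴵ w → lightBelow b ≤ lightBefore w
    lightBelow≤lightBefore b<w = count-mono λ x h → ∧-true (∧-trueˡ h) (≺⇒≺ᵇ x w
      (light-dᴵ<⇒≺ x w (lightK⇒light x (∧-trueˡ h)) ρw
        (+-cancelˡ-< #low _ _ (≤-<-trans (does-true⇒ (_ ≤? _) (∧-trueʳ {lightK x} h)) b<w))))

    heavy≢light : indeg D b ≢ indeg D w
    heavy≢light with #low + dᴵ w ≤? m + pos b
    ... | yes w≤b = >⇒≢ (subst₂ _<_ (sym indeg-light′) (sym indeg-heavy′)
                           (+-mono-≤-< w≤b (lightBefore<lightBelow w≤b)))
    ... | no w≰b  = <⇒≢ (subst₂ _<_ (sym indeg-heavy′) (sym indeg-light′)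
                           (+-mono-<-≤ (≰⇒> w≰b) (lightBelow≤lightBefore (≰⇒> w≰b))))

  ≺⇒indeg≢ : ∀ a b → inK a ≡ true → inK b ≡ true → a ≺ b → indeg D a ≢ indeg D b
  ≺⇒indeg≢ a b a∈K b∈K a≺b with roleView a | roleView b | pos-mono a b a∈K a≺b
  ... | _           | is-v₁ refl  | _     = ⊥-elim (¬≺v₁ a a≺b)
  ... | is-v₁ refl  | _           | pa<pb = <⇒≢ (begin-strict
      indeg D v₁  ≡⟨ trans indeg-v₁ (sym pos-v₁) ⟩
      pos v₁      <⟨ pa<pb ⟩
      pos b       ≤⟨ pos≤indeg b b∈K ⟩
      indeg D b   ∎)
    where open ≤-Reasoning
  ... | is-heavy ρa | is-heavy ρb | pa<pb =
    <⇒≢ (subst₂ _<_ (sym (indeg-heavy a a∈K ρa)) (sym (indeg-heavy b b∈K ρb))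
      (+-mono-<-≤ pa<pb (+-monoʳ-≤ m (lightBelow-mono a b (<⇒≤ pa<pb)))))
  ... | is-light ρa | is-light ρb | pa<pb =
    <⇒≢ (subst₂ _<_ (sym (indeg-light a a∈K ρa)) (sym (indeg-light b b∈K ρb))
      (+-mono-<-≤ pa<pb (light≺light⇒dᴵ≤ a b ρa ρb a≺b)))
  ... | is-heavy ρa | is-light ρb | _     = heavy≢light a b a∈K ρa b∈K ρb
  ... | is-light ρa | is-heavy ρb | _
    with s≤s () ← subst₂ _≤_ (tier-light ρa) (tier-heavy ρb) (lexKey-<⇒≤ tier {a} {b} a≺b)

  proper : Proper D
  proper a b ab with true⊎false (inK a) | true⊎false (inK b)
  ... | inj₁ a∈K | inj₁ b∈K with ≺-connex a b (adj⇒≢ G ab)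
  ...   | inj₁ a≺b = ≺⇒indeg≢ a b a∈K b∈K a≺b
  ...   | inj₂ b≺a = ≢-sym (≺⇒indeg≢ b a b∈K a∈K b≺a)
  proper a b ab | inj₁ a∈K | inj₂ b∉K = K-I-distinct a b b∉K ab
  proper a b ab | inj₂ a∉K | inj₁ b∈K = ≢-sym (K-I-distinct b a a∉K (trans (Graph.sym G b a) ab))
  proper a b ab | inj₂ a∉K | inj₂ b∉K with () ← trans (sym ab) (I-nonadjacent a∉K b∉K)

theorem15 : ∀ (n : ℕ) (G : Graph n) (ω : ℕ) →
    IsSplit G → IsCliqueNumber G ω →
    ProperOrientedChromatic≤ G (2 * ω ∸ 2)
theorem15 n G ω (K , K-clique , I-independent) (_ , clique≤ω) with nonempty? K
... | yes (v₁ , v₁∈K) = D , proper , bounded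
  where open SplitOrientation G ω K K-clique I-independent clique≤ω v₁ ([]=⇒lookup v₁∈K)
... | no K-empty = edgeless⇒ProperOrientedChromatic≤ G (2 * ω ∸ 2) λ u v → I-independent u v (∈I u) (∈I v)
  where
  ∈I : ∀ u → u ∈ ∁ K
  ∈I u = x∉p⇒x∈∁p (λ u∈K → K-empty (u , u∈K))
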